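{- Let $T$ be a tree with $n\ge1$ vertices, let $t\ge1$ be an integer, and let $s$ be a $t$-dilated configuration on $T$. Suppose there is a finite set $\{T_1,\dots,T_k\}$ of subtrees of $T$ such that every vertex of $T$ lies in some $T_i$, and $s$ forms a minimally $t$-dilated configuration on $T_i$ for every $i\in\{1,\dots,k\}$. Then $s$ is minimally $t$-dilated on $T$.
   Context: Label the vertices $v_1,\dots,v_n$. A chip configuration on $T$ is a vector $s\in\mathbb{Z}_{\ge0}^n$ ($s_i$ chips on $v_i$); the number of chips of $s$ on a subtree is the sum of its entries over the subtree's vertices. A subtree is a nonempty connected subgraph. For $t\ge1$, $s$ is $t$-dilated on a tree $T'$ (with $T'$ a subtree of $T$, considering the restriction of $s$) if $s$ has at least $t(m-1)$ chips on every $m$-vertex subtree of $T'$; it is minimally $t$-dilated on $T'$ if in addition it has exactly $t(|V(T')|-1)$ chips on $T'$. "Forms a minimally $t$-dilated configuration on $T'$" means the restriction of $s$ to $T'$ is minimally $t$-dilated on $T'$. -}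

module Defs where

open import Data.Nat using (ℕ; zero; suc; _+_; _*_; _∸_; _≤_; _≥_)
open import Data.Bool using (Bool; true; false; T; if_then_else_)
open import Data.Fin using (Fin)
open import Data.Fin.Subset using (Subset; _∈_; _⊆_; ∣_∣; Nonempty)
import Data.Fin.Subset as Sub
open import Data.Vec using (lookup)
open import Data.List using (List; []; _∷_; length; _++_; map; allFin)
open import Data.Nat.ListAction using (sum)
open import Data.List.Relation.Unary.Unique.Propositional using (Unique)
open import Data.Product using (_×_; Σ)
open import Relation.Nullary using (¬_)
open import Relation.Binary.PropositionalEquality using (_≡_)

record Graph (n : ℕ) : Set where
  field
    adj   : Fin n → Fin n → Bool
    sym   : ∀ u v → adj u v ≡ adj v u
    irrefl : ∀ u → adj u u ≡ false
open Graph public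

Edge : ∀ {n} → Graph n → Fin n → Fin n → Set
Edge G u v = T (adj G u v)

data WalkIn {n} (G : Graph n) (S : Subset n) : Fin n → Fin n → Set where
  here : ∀ {u} → u ∈ S → WalkIn G S u u
  step : ∀ {u w v} → u ∈ S → Edge G u w → WalkIn G S w v → WalkIn G S u v

ConnectedOn : ∀ {n} → Graph n → Subset n → Set
ConnectedOn G S = ∀ u v → u ∈ S → v ∈ S → WalkIn G S u v

data IsPath {n} (G : Graph n) : List (Fin n) → Set where
  single : ∀ v → IsPath G (v ∷ [])
  cons   : ∀ u v vs → Edge G u v → IsPath G (v ∷ vs) → IsPath G (u ∷ v ∷ vs)

IsCycle : ∀ {n} → Graph n → Fin n → List (Fin n) → Set
IsCycle G v₀ rest =
  Unique (v₀ ∷ rest) × (2 ≤ length rest) × IsPath G (v₀ ∷ rest ++ v₀ ∷ [])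

allV : ∀ {n} → Subset n
allV = Sub.⊤

IsTree : ∀ {n} → Graph n → Set
IsTree {n} G = ConnectedOn G allV × (∀ v₀ rest → ¬ IsCycle G v₀ rest)

-- A subtree (nonempty connected subgraph) of the tree, identified with its
-- vertex set: a connected subgraph of a tree is the induced subgraph on its
-- vertex set.
IsSubtree : ∀ {n} → Graph n → Subset n → Set
IsSubtree G S = Nonempty S × ConnectedOn G S

Config : ℕ → Set
Config n = Fin n → ℕ

chipsOn : ∀ {n} → Config n → Subset n → ℕ
chipsOn {n} s S = sum (map (λ i → if lookup S i then s i else 0) (allFin n))

Dilated : ∀ {n} → Graph n → ℕ → Config n → Subset n → Set
Dilated G t s U = ∀ S → IsSubtree G S → S ⊆ U → chipsOn s S ≥ t * (∣ S ∣ ∸ 1)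

MinDilated : ∀ {n} → Graph n → ℕ → Config n → Subset n → Set
MinDilated G t s U = Dilated G t s U × chipsOn s U ≡ t * (∣ U ∣ ∸ 1)

{-# OPTIONS --safe #-}

-- Call a subtree U tight if s has exactly t(|U| - 1) chips on it.  Both the number of chips and
-- t·|·| satisfy inclusion–exclusion, so for tight U and V whose union is a subtree (and hence
-- carries at least t(|U ∪ V| - 1) chips) the intersection carries at most t(|U ∩ V| - 1).  In a
-- tree a nonempty intersection of subtrees is a subtree, so then both U ∩ V and U ∪ V are
-- tight; an empty intersection would need a negative number of chips, so adjacent tight
-- subtrees always overlap.  Starting from one Tᵢ, a tight subtree that misses a vertex has an
-- edge leaving it, and merging with a Tᵢ containing the outer endpoint gives a larger tight
-- subtree, until the whole tree is reached.

module Submission where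

open import Defs hiding (sym)
open import Data.Nat using (ℕ; _≥_)
open import Data.Fin using (Fin)
open import Data.Fin.Subset using (Subset; _∈_)
open import Data.Product using (_×_; ∃)

open import Algebra.Properties.CommutativeSemigroup using (interchange)
open import Data.Bool using (true; false; T; _∨_; _∧_; if_then_else_)
open import Data.Empty using (⊥-elim)
open import Data.Fin using (zero)
open import Data.Fin.Properties using () renaming (_≟_ to _≟ᶠ_)
open import Data.Fin.Subset
  using (_∉_; _⊆_; _∪_; _∩_; ⊤; ⊥; ∁; ⁅_⁆; _⊂_; _⊃_; ∣_∣; Nonempty)
open import Data.Fin.Subset.Induction using (⊃-wellFounded; Acc; acc)
open import Data.Fin.Subset.Properties
  using (_∈?_; nonempty?; ∈⊤; ⊆⊤; ⊆-antisym; Empty-unique; ∣⊥∣≡0; ∣⁅x⁆∣≡1; x∈⁅y⁆⇒x≡y;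
         p⊆q⇒∣p∣≤∣q∣; x∈p∩q⁺; x∈p∩q⁻; x∈p∪q⁻; p⊆p∪q; q⊆p∪q; x∈∁p⇒x∉p; x∉∁p⇒x∈p)
open import Data.List using (List; []; _∷_; _++_; map; allFin)
open import Data.List.Membership.Propositional using () renaming (_∈_ to _∈ₗ_)
open import Data.List.Properties using (map-cong)
open import Data.List.Relation.Binary.Subset.Propositional using () renaming (_⊆_ to _⊆ₗ_)
open import Data.List.Relation.Binary.Subset.Propositional.Properties using (∷⁺ʳ)
open import Data.List.Relation.Unary.All as All using (All; []; _∷_)
open import Data.List.Relation.Unary.All.Properties using (anti-mono; ¬Any⇒All¬; ++⁺)
open import Data.List.Relation.Unary.Any using (here; there)
open import Data.List.Relation.Unary.Unique.Propositional using (Unique; []; _∷_)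
open import Data.Nat using (suc; _+_; _*_; _∸_; _≤_; _>_; z≤n; s≤s)
open import Data.Nat.ListAction using (sum)
open import Data.Nat.Properties
  using (+-comm; +-suc; *-suc; *-zeroʳ; *-distribˡ-+; +-cancelˡ-≤; +-cancelʳ-≡; +-monoˡ-≤;
         ≤-antisym; ≤-trans; +-commutativeSemigroup; module ≤-Reasoning)
open import Data.Product using (_,_; proj₁; proj₂)
open import Data.Sum using (inj₁; inj₂)
open import Data.Vec using ([]; _∷_; lookup)
open import Data.Vec.Properties using (lookup-zipWith; lookup-replicate)
open import Function using (_∘_; id)
open import Relation.Nullary using (¬_; yes; no; contradiction)
open import Relation.Binary.PropositionalEquality
  using (_≡_; _≢_; refl; sym; trans; cong; cong₂; subst; module ≡-Reasoning)

private
  variable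
    n : ℕ
    u v w x y : Fin n
    p S U V : Subset n
    vs ws : List (Fin n)

+-interchange : ∀ a b c d → (a + b) + (c + d) ≡ (a + c) + (b + d)
+-interchange = interchange +-commutativeSemigroup

*-pred+ : ∀ t {m} → m > 0 → t * (m ∸ 1) + t ≡ t * m
*-pred+ t {suc m} _ = trans (+-comm (t * m) t) (sym (*-suc t m))

m≤x∧x+y≡m+n⇒y≤n : ∀ {m n x y} → m ≤ x → x + y ≡ m + n → y ≤ n
m≤x∧x+y≡m+n⇒y≤n {m} {n} {x} {y} m≤x eq = +-cancelˡ-≤ m y n (begin
  m + y  ≤⟨ +-monoˡ-≤ y m≤x ⟩
  x + y  ≡⟨ eq ⟩
  m + n  ∎)
  where open ≤-Reasoning

sum-map-+ : ∀ {A : Set} (f g : A → ℕ) xs →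
            sum (map f xs) + sum (map g xs) ≡ sum (map (λ a → f a + g a) xs)
sum-map-+ f g [] = refl
sum-map-+ f g (a ∷ xs) =
  trans (+-interchange (f a) _ (g a) _) (cong (f a + g a +_) (sum-map-+ f g xs))

sum-map-zero : ∀ {A : Set} (f : A → ℕ) xs → (∀ a → f a ≡ 0) → sum (map f xs) ≡ 0
sum-map-zero f [] _ = refl
sum-map-zero f (a ∷ xs) f≡0 = cong₂ _+_ (f≡0 a) (sum-map-zero f xs f≡0)

nonempty⇒∣p∣>0 : Nonempty p → ∣ p ∣ > 0
nonempty⇒∣p∣>0 {p = p} (x , x∈p) = subst (_≤ ∣ p ∣) (∣⁅x⁆∣≡1 x) (p⊆q⇒∣p∣≤∣q∣ ⁅x⁆⊆p)
  where
  ⁅x⁆⊆p : ⁅ x ⁆ ⊆ p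
  ⁅x⁆⊆p y∈⁅x⁆ = subst (_∈ p) (sym (x∈⁅y⁆⇒x≡y x y∈⁅x⁆)) x∈p

∣p∪q∣+∣p∩q∣≡∣p∣+∣q∣ : ∀ (p q : Subset n) → ∣ p ∪ q ∣ + ∣ p ∩ q ∣ ≡ ∣ p ∣ + ∣ q ∣
∣p∪q∣+∣p∩q∣≡∣p∣+∣q∣ [] [] = refl
∣p∪q∣+∣p∩q∣≡∣p∣+∣q∣ (true ∷ p) (true ∷ q)
  rewrite +-suc ∣ p ∪ q ∣ ∣ p ∩ q ∣ | +-suc ∣ p ∣ ∣ q ∣ = cong (suc ∘ suc) (∣p∪q∣+∣p∩q∣≡∣p∣+∣q∣ p q)
∣p∪q∣+∣p∩q∣≡∣p∣+∣q∣ (true ∷ p) (false ∷ q) = cong suc (∣p∪q∣+∣p∩q∣≡∣p∣+∣q∣ p q)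
∣p∪q∣+∣p∩q∣≡∣p∣+∣q∣ (false ∷ p) (true ∷ q)
  rewrite +-suc ∣ p ∣ ∣ q ∣ = cong suc (∣p∪q∣+∣p∩q∣≡∣p∣+∣q∣ p q)
∣p∪q∣+∣p∩q∣≡∣p∣+∣q∣ (false ∷ p) (false ∷ q) = ∣p∪q∣+∣p∩q∣≡∣p∣+∣q∣ p q

if∨+if∧≡if+if : ∀ a b m → (if a ∨ b then m else 0) + (if a ∧ b then m else 0)
                          ≡ (if a then m else 0) + (if b then m else 0)
if∨+if∧≡if+if true  true  m = refl
if∨+if∧≡if+if true  false m = refl
if∨+if∧≡if+if false true  m = +-comm m 0
if∨+if∧≡if+if false false m = refl

chipsOn-∪∩ : ∀ (s : Config n) p q →
             chipsOn s (p ∪ q) + chipsOn s (p ∩ q) ≡ chipsOn s p + chipsOn s q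
chipsOn-∪∩ {n} s p q = begin
  chipsOn s (p ∪ q) + chipsOn s (p ∩ q)
    ≡⟨ sum-map-+ (chip (p ∪ q)) (chip (p ∩ q)) (allFin n) ⟩
  sum (map (λ i → chip (p ∪ q) i + chip (p ∩ q) i) (allFin n))
    ≡⟨ cong sum (map-cong pointwise (allFin n)) ⟩
  sum (map (λ i → chip p i + chip q i) (allFin n))
    ≡⟨ sum-map-+ (chip p) (chip q) (allFin n) ⟨
  chipsOn s p + chipsOn s q ∎
  where
  open ≡-Reasoning
  chip : Subset n → Fin n → ℕ
  chip S i = if lookup S i then s i else 0
  pointwise : ∀ i → chip (p ∪ q) i + chip (p ∩ q) i ≡ chip p i + chip q i
  pointwise i rewrite lookup-zipWith _∨_ i p q | lookup-zipWith _∧_ i p q =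
    if∨+if∧≡if+if (lookup p i) (lookup q i) (s i)

chipsOn-⊥ : ∀ (s : Config n) → chipsOn s ⊥ ≡ 0
chipsOn-⊥ {n} s =
  sum-map-zero _ (allFin n) (λ i → cong (if_then s i else 0) (lookup-replicate i false))

Acyclic : Graph n → Set
Acyclic G = ∀ v₀ rest → ¬ IsCycle G v₀ rest

module Walks {n : ℕ} (G : Graph n) where

  open import Data.List.Membership.DecPropositional (_≟ᶠ_ {n}) using () renaming (_∈?_ to _∈ₗ?_)

  Edge-sym : Edge G u v → Edge G v u
  Edge-sym {u} {v} = subst T (Graph.sym G u v)

  walkIn-source : WalkIn G S u v → u ∈ S
  walkIn-source (here u∈) = u∈
  walkIn-source (step u∈ _ _) = u∈

  walkIn-trans : WalkIn G S u v → WalkIn G S v w → WalkIn G S u w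
  walkIn-trans (here _) q = q
  walkIn-trans (step u∈ e p) q = step u∈ e (walkIn-trans p q)

  walkIn-sym : WalkIn G S u v → WalkIn G S v u
  walkIn-sym (here u∈) = here u∈
  walkIn-sym (step u∈ e p) =
    walkIn-trans (walkIn-sym p) (step (walkIn-source p) (Edge-sym e) (here u∈))

  walkIn-mono : U ⊆ V → WalkIn G U u v → WalkIn G V u v
  walkIn-mono U⊆V (here u∈) = here (U⊆V u∈)
  walkIn-mono U⊆V (step u∈ e p) = step (U⊆V u∈) e (walkIn-mono U⊆V p)

  exit-edge : WalkIn G S u v → u ∈ U → v ∉ U → ∃ λ x → ∃ λ y → x ∈ U × y ∉ U × Edge G x y
  exit-edge (here _) u∈ v∉ = ⊥-elim (v∉ u∈)
  exit-edge {U = U} (step {w = w} _ e p) u∈ v∉ with w ∈? U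
  ... | yes w∈ = exit-edge p w∈ v∉
  ... | no w∉ = _ , _ , u∈ , w∉ , e

  -- Walk u v vs: a walk from u to v whose vertices after u are vs.
  data Walk : Fin n → Fin n → List (Fin n) → Set where
    stop : Walk u u []
    _▸_  : Edge G u v → Walk v w vs → Walk u w (v ∷ vs)

  infixr 5 _▸_ _++ʷ_

  _++ʷ_ : Walk u v vs → Walk v w ws → Walk u w (vs ++ ws)
  stop ++ʷ q = q
  (e ▸ p) ++ʷ q = e ▸ (p ++ʷ q)

  walk⇒IsPath : Walk u v vs → IsPath G (u ∷ vs)
  walk⇒IsPath stop = single _
  walk⇒IsPath (e ▸ p) = cons _ _ _ e (walk⇒IsPath p)

  walkIn⇒walk : WalkIn G S u v → ∃ λ vs → Walk u v vs × All (_∈ S) (u ∷ vs)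
  walkIn⇒walk (here u∈) = [] , stop , u∈ ∷ []
  walkIn⇒walk (step u∈ e p) = let (_ , q , q∈S) = walkIn⇒walk p in _ , e ▸ q , u∈ ∷ q∈S

  walk⇒walkIn : Walk u v vs → All (_∈ S) (u ∷ vs) → WalkIn G S u v
  walk⇒walkIn stop (u∈ ∷ []) = here u∈
  walk⇒walkIn (e ▸ p) (u∈ ∷ p∈S) = step u∈ e (walk⇒walkIn p p∈S)

  drop-until : Walk u v vs → Unique (u ∷ vs) → x ∈ₗ u ∷ vs →
               ∃ λ ws → Walk x v ws × Unique (x ∷ ws) × ws ⊆ₗ vs
  drop-until p uniq (here refl) = _ , p , uniq , id
  drop-until (e ▸ p) (_ ∷ uniq) (there x∈) =
    let (ws , q , uniq′ , ws⊆) = drop-until p uniq x∈ in ws , q , uniq′ , there ∘ ws⊆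

  erase-loops : Walk u v vs → ∃ λ ws → Walk u v ws × Unique (u ∷ ws) × ws ⊆ₗ vs
  erase-loops stop = [] , stop , [] ∷ [] , id
  erase-loops {u} (_▸_ {v = w} e p) with erase-loops p
  ... | ws , q , uniq , ws⊆ with u ∈ₗ? w ∷ ws
  ...   | yes u∈ =
    let (ws′ , q′ , uniq′ , ws′⊆) = drop-until q uniq u∈ in ws′ , q′ , uniq′ , there ∘ ws⊆ ∘ ws′⊆
  ...   | no u∉ = w ∷ ws , e ▸ q , ¬Any⇒All¬ _ u∉ ∷ uniq , ∷⁺ʳ w ws⊆

  -- Otherwise the loop-erased walk w ⋯ u closes up through u — v — w into a cycle.
  acyclic-detour : Acyclic G → Edge G u v → Edge G v w → Walk w u vs → All (v ≢_) (w ∷ vs) →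
                   w ≡ u
  acyclic-detour acyclic uv vw p v∉ with erase-loops p
  ... | [] , stop , _ , _ = refl
  ... | ws@(_ ∷ _) , q , uniq , ws⊆ = contradiction cycle (acyclic _ (_ ∷ ws))
    where
    cycle : IsCycle G _ (_ ∷ ws)
    cycle = anti-mono (∷⁺ʳ _ ws⊆) v∉ ∷ uniq
          , s≤s (s≤s z≤n)
          , cons _ _ _ vw (walk⇒IsPath (q ++ʷ uv ▸ stop))

  cannot-exit : Acyclic G → ConnectedOn G S → u ∈ S → v ∈ S → w ∉ S →
                Edge G u w → Walk w v vs → ¬ Unique (u ∷ w ∷ vs)
  cannot-exit acyclic conn u∈ v∈ w∉ uw stop _ = w∉ v∈
  cannot-exit {S = S} {w = w} acyclic conn u∈ v∈ w∉ uw (wx ▸ p) ((_ ∷ u≢x ∷ _) ∷ w∉p ∷ _) =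
    let (_ , back , back∈S) = walkIn⇒walk (conn _ _ v∈ u∈)
        w∉back = All.map outside (All.tail back∈S)
    in u≢x (sym (acyclic-detour acyclic uw wx (p ++ʷ back) (++⁺ w∉p w∉back)))
    where
    outside : y ∈ S → w ≢ y
    outside y∈ refl = w∉ y∈

  simple-walk-within : Acyclic G → ConnectedOn G S → Walk u v vs → Unique (u ∷ vs) →
                       u ∈ S → v ∈ S → All (_∈ S) vs
  simple-walk-within acyclic conn stop _ _ _ = []
  simple-walk-within {S = S} acyclic conn (_▸_ {v = w} e p) uniq@(_ ∷ uniq′) u∈ v∈ with w ∈? S
  ... | yes w∈ = w∈ ∷ simple-walk-within acyclic conn p uniq′ w∈ v∈
  ... | no w∉ = ⊥-elim (cannot-exit acyclic conn u∈ v∈ w∉ e p uniq)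

  ∩-connected : Acyclic G → ConnectedOn G U → ConnectedOn G V → ConnectedOn G (U ∩ V)
  ∩-connected {U = U} {V = V} acyclic cU cV u v u∈ v∈ =
    let (u∈U , u∈V) = x∈p∩q⁻ U V u∈
        (v∈U , v∈V) = x∈p∩q⁻ U V v∈
        (_ , p , p∈U) = walkIn⇒walk (cU u v u∈U v∈U)
        (_ , q , uniq , q⊆p) = erase-loops p
        q∈U = anti-mono (∷⁺ʳ u q⊆p) p∈U
        q∈V = u∈V ∷ simple-walk-within acyclic cV q uniq u∈V v∈V
    in walk⇒walkIn q (All.zipWith x∈p∩q⁺ (q∈U , q∈V))

  ∪-connected : ConnectedOn G U → ConnectedOn G V → u ∈ U → v ∈ V → WalkIn G (U ∪ V) u v →
                ConnectedOn G (U ∪ V)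
  ∪-connected {U = U} {V = V} {u = u} {v = v} cU cV u∈U v∈V link x y x∈ y∈
    with x∈p∪q⁻ U V x∈ | x∈p∪q⁻ U V y∈
  ... | inj₁ x∈U | inj₁ y∈U = walkIn-mono (p⊆p∪q V) (cU x y x∈U y∈U)
  ... | inj₂ x∈V | inj₂ y∈V = walkIn-mono (q⊆p∪q U V) (cV x y x∈V y∈V)
  ... | inj₁ x∈U | inj₂ y∈V =
    walkIn-trans (walkIn-mono (p⊆p∪q V) (cU x u x∈U u∈U))
      (walkIn-trans link (walkIn-mono (q⊆p∪q U V) (cV v y v∈V y∈V)))
  ... | inj₂ x∈V | inj₁ y∈U =
    walkIn-trans (walkIn-mono (q⊆p∪q U V) (cV x v x∈V v∈V))
      (walkIn-trans (walkIn-sym link) (walkIn-mono (p⊆p∪q V) (cU u y u∈U y∈U)))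

module Tightness {n : ℕ} (G : Graph n) (t : ℕ) (s : Config n) where

  open Walks G

  -- t (∣ U ∣ - 1) chips, stated without truncated subtraction.
  Tight : Subset n → Set
  Tight U = IsSubtree G U × chipsOn s U + t ≡ t * ∣ U ∣

  minDilated⇒tight : IsSubtree G U → MinDilated G t s U → Tight U
  minDilated⇒tight sub (_ , count) =
    sub , trans (cong (_+ t) count) (*-pred+ t (nonempty⇒∣p∣>0 (proj₁ sub)))

  tight⇒count : Tight U → chipsOn s U ≡ t * (∣ U ∣ ∸ 1)
  tight⇒count ((ne , _) , count) =
    +-cancelʳ-≡ _ _ _ (trans count (sym (*-pred+ t (nonempty⇒∣p∣>0 ne))))

  tight-∪∩ : Tight U → Tight V →
             (chipsOn s (U ∪ V) + t) + (chipsOn s (U ∩ V) + t) ≡ t * ∣ U ∪ V ∣ + t * ∣ U ∩ V ∣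
  tight-∪∩ {U = U} {V = V} (_ , tU) (_ , tV) = begin
    (chipsOn s (U ∪ V) + t) + (chipsOn s (U ∩ V) + t)
      ≡⟨ +-interchange (chipsOn s (U ∪ V)) t (chipsOn s (U ∩ V)) t ⟩
    (chipsOn s (U ∪ V) + chipsOn s (U ∩ V)) + (t + t)
      ≡⟨ cong (_+ (t + t)) (chipsOn-∪∩ s U V) ⟩
    (chipsOn s U + chipsOn s V) + (t + t)
      ≡⟨ +-interchange (chipsOn s U) (chipsOn s V) t t ⟩
    (chipsOn s U + t) + (chipsOn s V + t)
      ≡⟨ cong₂ _+_ tU tV ⟩
    t * ∣ U ∣ + t * ∣ V ∣
      ≡⟨ *-distribˡ-+ t ∣ U ∣ ∣ V ∣ ⟨
    t * (∣ U ∣ + ∣ V ∣)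
      ≡⟨ cong (t *_) (∣p∪q∣+∣p∩q∣≡∣p∣+∣q∣ U V) ⟨
    t * (∣ U ∪ V ∣ + ∣ U ∩ V ∣)
      ≡⟨ *-distribˡ-+ t ∣ U ∪ V ∣ ∣ U ∩ V ∣ ⟩
    t * ∣ U ∪ V ∣ + t * ∣ U ∩ V ∣ ∎
    where open ≡-Reasoning

  module _ (dil : Dilated G t s allV) where

    subtree-bound : IsSubtree G S → t * ∣ S ∣ ≤ chipsOn s S + t
    subtree-bound {S = S} sub = begin
      t * ∣ S ∣            ≡⟨ *-pred+ t (nonempty⇒∣p∣>0 (proj₁ sub)) ⟨
      t * (∣ S ∣ ∸ 1) + t  ≤⟨ +-monoˡ-≤ t (dil S sub ⊆⊤) ⟩
      chipsOn s S + t      ∎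
      where open ≤-Reasoning

    tight-∩-deficit : Tight U → Tight V → IsSubtree G (U ∪ V) →
                      chipsOn s (U ∩ V) + t ≤ t * ∣ U ∩ V ∣
    tight-∩-deficit tU tV sub∪ = m≤x∧x+y≡m+n⇒y≤n (subtree-bound sub∪) (tight-∪∩ tU tV)

    tight-∪ : Acyclic G → Tight U → Tight V → Nonempty (U ∩ V) → Tight (U ∪ V)
    tight-∪ {U = U} {V = V} acyclic tU@((_ , cU) , _) tV@((_ , cV) , _) (x , x∈U∩V) = sub∪ , count∪
      where
      x∈U = proj₁ (x∈p∩q⁻ U V x∈U∩V)
      x∈V = proj₂ (x∈p∩q⁻ U V x∈U∩V)
      sub∪ : IsSubtree G (U ∪ V)
      sub∪ = (x , p⊆p∪q V x∈U) , ∪-connected cU cV x∈U x∈V (here (p⊆p∪q V x∈U))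
      sub∩ : IsSubtree G (U ∩ V)
      sub∩ = (x , x∈U∩V) , ∩-connected acyclic cU cV
      count∩ : chipsOn s (U ∩ V) + t ≡ t * ∣ U ∩ V ∣
      count∩ = ≤-antisym (tight-∩-deficit tU tV sub∪) (subtree-bound sub∩)
      count∪ : chipsOn s (U ∪ V) + t ≡ t * ∣ U ∪ V ∣
      count∪ = +-cancelʳ-≡ _ _ _ (trans (tight-∪∩ tU tV) (cong (t * ∣ U ∪ V ∣ +_) (sym count∩)))

    tight-adjacent⇒overlap : t ≥ 1 → Tight U → Tight V → u ∈ U → v ∈ V → Edge G u v →
                             Nonempty (U ∩ V)
    tight-adjacent⇒overlap {U = U} {V = V} t≥1 tU@((_ , cU) , _) tV@((_ , cV) , _) u∈U v∈V uv
      with nonempty? (U ∩ V)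
    ... | yes meet = meet
    ... | no disjoint = contradiction (≤-trans t≥1 t≤0) λ ()
      where
      link : WalkIn G (U ∪ V) _ _
      link = step (p⊆p∪q V u∈U) uv (here (q⊆p∪q U V v∈V))
      sub∪ : IsSubtree G (U ∪ V)
      sub∪ = (_ , p⊆p∪q V u∈U) , ∪-connected cU cV u∈U v∈V link
      t≤0 : t ≤ 0
      t≤0 = begin
        t                ≡⟨ cong (_+ t) (chipsOn-⊥ s) ⟨
        chipsOn s ⊥ + t  ≤⟨ subst (λ W → chipsOn s W + t ≤ t * ∣ W ∣) (Empty-unique disjoint)
                                  (tight-∩-deficit tU tV sub∪) ⟩
        t * ∣ ⊥ {n} ∣    ≡⟨ cong (t *_) (∣⊥∣≡0 n) ⟩
        t * 0            ≡⟨ *-zeroʳ t ⟩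
        0                ∎
        where open ≤-Reasoning

    module _ (tree : IsTree G) (t≥1 : t ≥ 1) (covered : ∀ v → ∃ λ V → v ∈ V × Tight V) where

      tight-extend : Tight U → x ∉ U → ∃ λ W → U ⊂ W × Tight W
      tight-extend {U = U} {x = x} tU@(((u , u∈U) , _) , _) x∉U =
        let (a , b , a∈U , b∉U , ab) = exit-edge (proj₁ tree u x ∈⊤ ∈⊤) u∈U x∉U
            (V , b∈V , tV) = covered b
        in U ∪ V , (p⊆p∪q V , b , q⊆p∪q U V b∈V , b∉U)
                 , tight-∪ (proj₂ tree) tU tV (tight-adjacent⇒overlap t≥1 tU tV a∈U b∈V ab)

      tight-⊤ : Tight U → Tight ⊤
      tight-⊤ = grow (⊃-wellFounded _)
        where
        grow : Acc _⊃_ U → Tight U → Tight ⊤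
        grow {U = U} (acc larger) tU with nonempty? (∁ U)
        ... | yes (x , x∈∁U) =
          let (W , U⊂W , tW) = tight-extend tU (x∈∁p⇒x∉p x∈∁U) in grow (larger U⊂W) tW
        ... | no ∁U-empty = subst Tight (⊆-antisym ⊆⊤ ⊤⊆U) tU
          where
          ⊤⊆U : ⊤ ⊆ U
          ⊤⊆U {x} _ = x∉∁p⇒x∈p (∁U-empty ∘ (x ,_))

lemma4p5 : (n : ℕ) → n ≥ 1 → (T : Graph n) → IsTree T →
    (t : ℕ) → t ≥ 1 → (s : Config n) → Dilated T t s allV →
    (k : ℕ) → (Ts : Fin k → Subset n) → (∀ i → IsSubtree T (Ts i)) →
    (∀ v → ∃ λ i → v ∈ Ts i) →
    (∀ i → MinDilated T t s (Ts i)) →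
    MinDilated T t s allV
lemma4p5 (suc n) _ G tree t t≥1 s dil k Ts subtrees cover mins =
  dil , tight⇒count (tight-⊤ dil tree t≥1 covered (tight-Ts (proj₁ (cover zero))))
  where
  open Tightness G t s
  tight-Ts : ∀ i → Tight (Ts i)
  tight-Ts i = minDilated⇒tight (subtrees i) (mins i)
  covered : ∀ v → ∃ λ V → v ∈ V × Tight V
  covered v = let (i , v∈Ti) = cover v in Ts i , v∈Ti , tight-Ts i
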